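{- Let $G$ be a digraph on $n$ vertices with $\delta^0(G)\geq n/2$. Let $d\geq0$ and suppose $A,B,S,T$ is a partition of $V(G)$ into sets of sizes $a,b,s,t$ with $t\geq s\geq d+2$ and $b=a+d$. Then $G$ contains a collection $M$ of $d+1$ edges in $E(T,S\cup B)\cup E(B,S)$ such that the endvertices of the edges of $M$ that lie outside $B$ are all distinct, and each vertex of $B$ is an endvertex of at most one $TB$-edge of $M$ and of at most one $BS$-edge of $M$. Moreover, if $e(T,S)>0$, then $M$ contains a $TS$-edge.
   Context: Digraphs have no loops and at most one edge in each direction between two vertices; $\delta^0(G)$ is the minimum semidegree. $E(X,Y)$ is the set of edges $xy$ with $x\in X$, $y\in Y$ (called $XY$-edges), and $e(X,Y)=|E(X,Y)|$. -}

module Defs where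

open import Data.Nat using (ℕ; zero; suc; _+_)
open import Data.Bool using (Bool; true; false)
open import Data.Fin using (Fin; zero; suc)
open import Data.Product using (_×_; _,_; Σ; ∃)
open import Data.Sum using (_⊎_)
open import Relation.Binary.PropositionalEquality using (_≡_; _≢_)

count : ∀ {n} → (Fin n → Bool) → ℕ
count {zero} P = 0
count {suc n} P with P zero
... | true = suc (count (λ i → P (suc i)))
... | false = count (λ i → P (suc i))

-- A digraph on vertex set Fin n: Boolean adjacency (u → v edge iff adj u v ≡ true).
-- Using a relation automatically gives at most one edge in each direction;
-- looplessness is imposed explicitly.
record Digraph (n : ℕ) : Set where
  field
    adj      : Fin n → Fin n → Bool
    loopless : ∀ v → adj v v ≡ false
open Digraph public

outdeg : ∀ {n} → Digraph n → Fin n → ℕ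
outdeg G v = count (λ w → adj G v w)

indeg : ∀ {n} → Digraph n → Fin n → ℕ
indeg G v = count (λ w → adj G w v)

-- δ⁰(G) ≥ n/2, stated without division: 2·deg ≥ n for all in- and out-degrees.
MinSemidegreeHalf : ∀ {n} → Digraph n → Set
MinSemidegreeHalf {n} G = ∀ v → (n Data.Nat.≤ outdeg G v + outdeg G v) × (n Data.Nat.≤ indeg G v + indeg G v)

data Part : Set where
  pA pB pS pT : Part

isPart : Part → Part → Bool
isPart pA pA = true
isPart pB pB = true
isPart pS pS = true
isPart pT pT = true
isPart _ _ = false

partSize : ∀ {n} → (Fin n → Part) → Part → ℕ
partSize lab X = count (λ v → isPart (lab v) X)

EdgeType : ∀ {n} → (Fin n → Part) → Part → Part → Fin n × Fin n → Set
EdgeType lab X Y (u , v) = (lab u ≡ X) × (lab v ≡ Y)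

Allowed : ∀ {n} → (Fin n → Part) → Fin n × Fin n → Set
Allowed lab e = EdgeType lab pT pS e ⊎ EdgeType lab pT pB e ⊎ EdgeType lab pB pS e

endpoint : ∀ {n} → Fin n × Fin n → Bool → Fin n
endpoint (u , v) false = u
endpoint (u , v) true  = v

GoodCollection : ∀ {n} → Digraph n → (Fin n → Part) → (d : ℕ) → (Fin (suc d) → Fin n × Fin n) → Set
GoodCollection G lab d M =
    (∀ i → adj G (Data.Product.proj₁ (M i)) (Data.Product.proj₂ (M i)) ≡ true)
  × (∀ i → Allowed lab (M i))
    -- endvertices outside B are all distinct (as endpoint occurrences)
  × (∀ i j (x y : Bool) → endpoint (M i) x ≡ endpoint (M j) y → lab (endpoint (M i) x) ≢ pB → (i ≡ j × x ≡ y))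
  × (∀ i j → EdgeType lab pT pB (M i) → EdgeType lab pT pB (M j)
       → Data.Product.proj₂ (M i) ≡ Data.Product.proj₂ (M j) → i ≡ j)
  × (∀ i j → EdgeType lab pB pS (M i) → EdgeType lab pB pS (M j)
       → Data.Product.proj₁ (M i) ≡ Data.Product.proj₁ (M j) → i ≡ j)

-- Build the collection one edge at a time, keeping tails pairwise distinct and heads pairwise
-- distinct; as tails lie in T ∪ B and heads in S ∪ B, a shared endvertex then lies in B. Given
-- k ≤ d edges, pick a vertex x ∈ T that is not a tail and y ∈ S that is not a head (|T|, |S| ≥ d + 2).
-- Add an edge x w with w ∈ S ∪ B not yet a head, or w y with w ∈ T ∪ B not yet a tail, or replace
-- some edge u v by x v and u y. If none is possible, then d⁺(x) ≤ a + (t - 1) + #{i : x vᵢ ∈ E} and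
-- d⁻(y) ≤ a + (s - 1) + #{i : uᵢ y ∈ E}, where the last two index sets are disjoint, so
-- d⁺(x) + d⁻(y) ≤ 2a + s + t + d - 2 = n - 2 < n. Starting from a TS-edge when there is one keeps a
-- TS-edge throughout, since replacing a TS-edge u v produces the TS-edge u y.

module Submission where

open import Defs
open import Data.Nat using (ℕ; zero; suc; _+_; _≤_; _<_; z≤n; s≤s)
open import Data.Nat.Properties hiding (_≟_)
open import Data.Nat.Tactic.RingSolver using (solve-∀)
open import Data.Fin using (Fin; zero; suc)
open import Data.Fin.Properties using (_≟_; any?)
open import Data.Bool using (Bool; true; false; _∧_; _∨_; not)
import Data.Bool as Bool
open import Data.Bool.Properties using (∧-conicalˡ; ∧-conicalʳ; ∨-zeroʳ)
open import Data.Product using (_×_; _,_; Σ; ∃; proj₁; proj₂)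
open import Data.Sum using (_⊎_; inj₁; inj₂)
open import Data.Empty using (⊥; ⊥-elim)
open import Data.Vec.Functional using (Vector; _∷_; updateAt)
open import Data.Vec.Functional.Properties using (updateAt-updates; updateAt-minimal)
open import Function using (_∘_; const; case_of_)
open import Function.Definitions using (Injective)
open import Relation.Nullary using (Dec; yes; no; ¬_; does)
open import Relation.Nullary.Decidable using (_×-dec_; ¬?; map′)
open import Relation.Binary.PropositionalEquality

private
  variable
    A : Set
    k m : ℕ

count-≤-size : (P : Fin m → Bool) → count P ≤ m
count-≤-size {zero} P = z≤n
count-≤-size {suc m} P with P zero
... | true = s≤s (count-≤-size (P ∘ suc))
... | false = m≤n⇒m≤1+n (count-≤-size (P ∘ suc))

count-true : (P : Fin (suc m) → Bool) → P zero ≡ true → count P ≡ suc (count (P ∘ suc))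
count-true P p₀ rewrite p₀ = refl

count-∘suc-≤ : (P : Fin (suc m) → Bool) → count (P ∘ suc) ≤ count P
count-∘suc-≤ P with P zero
... | true = n≤1+n _
... | false = ≤-refl

count-mono : (P Q : Fin m → Bool) → (∀ i → P i ≡ true → Q i ≡ true) → count P ≤ count Q
count-mono {zero} P Q P⊆Q = z≤n
count-mono {suc m} P Q P⊆Q with P zero in p₀ | count-mono (P ∘ suc) (Q ∘ suc) (P⊆Q ∘ suc)
... | false | IH = ≤-trans IH (count-∘suc-≤ Q)
... | true | IH rewrite count-true Q (P⊆Q zero p₀) = s≤s IH

count-≤-∪ : (P Q R : Fin m → Bool) → (∀ i → P i ≡ true → Q i ≡ true ⊎ R i ≡ true)
  → count P ≤ count Q + count R
count-≤-∪ {zero} P Q R P⊆Q∪R = z≤n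
count-≤-∪ {suc m} P Q R P⊆Q∪R
  with P zero in p₀ | count-≤-∪ (P ∘ suc) (Q ∘ suc) (R ∘ suc) (P⊆Q∪R ∘ suc)
... | false | IH = ≤-trans IH (+-mono-≤ (count-∘suc-≤ Q) (count-∘suc-≤ R))
... | true | IH with P⊆Q∪R zero p₀
...   | inj₁ q₀ rewrite count-true Q q₀ = s≤s (≤-trans IH (+-monoʳ-≤ _ (count-∘suc-≤ R)))
...   | inj₂ r₀ rewrite count-true R r₀ | +-suc (count Q) (count (R ∘ suc)) =
  s≤s (≤-trans IH (+-monoˡ-≤ _ (count-∘suc-≤ Q)))

count-disjoint : (P Q : Fin m → Bool) → (∀ i → P i ≡ true → Q i ≡ true → ⊥) → count P + count Q ≤ m
count-disjoint {zero} P Q P∩Q=∅ = z≤n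
count-disjoint {suc m} P Q P∩Q=∅
  with P zero in p₀ | Q zero in q₀ | count-disjoint (P ∘ suc) (Q ∘ suc) (P∩Q=∅ ∘ suc)
... | true | true | _ = ⊥-elim (P∩Q=∅ zero p₀ q₀)
... | true | false | IH = s≤s IH
... | false | true | IH rewrite +-suc (count (P ∘ suc)) (count (Q ∘ suc)) = s≤s IH
... | false | false | IH = m≤n⇒m≤1+n IH

_without_ : (Fin m → Bool) → Fin m → Fin m → Bool
(P without c) w = not (does (w ≟ c)) ∧ P w

without-⁻ : (P : Fin m → Bool) {c w : Fin m} → (P without c) w ≡ true → w ≢ c × P w ≡ true
without-⁻ P {c} {w} h with w ≟ c
... | no w≢c = w≢c , h

without-⁺ : (P : Fin m → Bool) {c w : Fin m} → w ≢ c → P w ≡ true → (P without c) w ≡ true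
without-⁺ P {c} {w} w≢c h with w ≟ c
... | yes w≡c = ⊥-elim (w≢c w≡c)
... | no _ = h

count-without : (P : Fin m → Bool) (c : Fin m) → P c ≡ true → count P ≡ suc (count (P without c))
count-without P zero p₀ = count-true P p₀
count-without P (suc c) pc with P zero
... | true = cong suc (count-without (P ∘ suc) c pc)
... | false = count-without (P ∘ suc) c pc

count-none : (P : Fin m → Bool) → (∀ i → P i ≢ true) → count P ≤ 0
count-none {zero} P none = z≤n
count-none {suc m} P none with P zero in p₀
... | true = ⊥-elim (none zero p₀)
... | false = count-none (P ∘ suc) (none ∘ suc)

count-≤-image : (P : Fin m → Bool) (g : Fin k → Fin m) → (∀ w → P w ≡ true → ∃ λ j → g j ≡ w)
  → count P ≤ count (P ∘ g)
count-≤-image {k = zero} P g P⊆img = count-none P (λ w pw → case P⊆img w pw of λ ())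
count-≤-image {m} {suc k} P g P⊆img = bound
  where
  open ≤-Reasoning
  P' : Fin m → Bool
  P' = P without g zero
  P'⊆img : ∀ w → P' w ≡ true → ∃ λ j → g (suc j) ≡ w
  P'⊆img w h with without-⁻ P h
  ... | w≢g0 , pw with P⊆img w pw
  ...   | zero , g0≡w = ⊥-elim (w≢g0 (sym g0≡w))
  ...   | suc j , gj≡w = j , gj≡w
  g0∉P : P (g zero) ≡ false → ∀ w → P w ≡ true → w ≢ g zero
  g0∉P pc w pw refl = case trans (sym pw) pc of λ ()
  P'-bound : count P' ≤ count (P ∘ g ∘ suc)
  P'-bound = ≤-trans (count-≤-image P' (g ∘ suc) P'⊆img)
                     (count-mono (P' ∘ g ∘ suc) (P ∘ g ∘ suc) (λ j → proj₂ ∘ without-⁻ P))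
  bound : count P ≤ count (P ∘ g)
  bound with P (g zero) in pc
  ... | true = begin
    count P                    ≡⟨ count-without P (g zero) pc ⟩
    suc (count P')             ≤⟨ s≤s P'-bound ⟩
    suc (count (P ∘ g ∘ suc))  ∎
  ... | false = begin
    count P                    ≤⟨ count-mono P P' (λ w pw → without-⁺ P (g0∉P pc w pw) pw) ⟩
    count P'                   ≤⟨ P'-bound ⟩
    count (P ∘ g ∘ suc)        ∎

missed-or-count-≤-image : (P : Fin m → Bool) (g : Fin k → Fin m)
  → (∃ λ w → P w ≡ true × ∀ j → g j ≢ w) ⊎ count P ≤ count (P ∘ g)
missed-or-count-≤-image P g with any? (λ w → (P w Bool.≟ true) ×-dec ¬? (any? (λ j → g j ≟ w)))
... | yes (w , pw , unhit) = inj₁ (w , pw , λ j gj≡w → unhit (j , gj≡w))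
... | no none = inj₂ (count-≤-image P g covered)
  where
  covered : ∀ w → P w ≡ true → ∃ λ j → g j ≡ w
  covered w pw with any? (λ j → g j ≟ w)
  ... | yes hit = hit
  ... | no unhit = ⊥-elim (none (w , pw , unhit))

count-≤-∪₃ : (P Q₁ Q₂ Q₃ : Fin m → Bool)
  → (∀ i → P i ≡ true → Q₁ i ≡ true ⊎ Q₂ i ≡ true ⊎ Q₃ i ≡ true)
  → count P ≤ count Q₁ + (count Q₂ + count Q₃)
count-≤-∪₃ {m} P Q₁ Q₂ Q₃ P⊆Q =
  ≤-trans (count-≤-∪ P Q₁ Q₂∨Q₃ P⊆Q₁∪Q₂∨Q₃) (+-monoʳ-≤ (count Q₁) (count-≤-∪ Q₂∨Q₃ Q₂ Q₃ ∨-elim))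
  where
  Q₂∨Q₃ : Fin m → Bool
  Q₂∨Q₃ i = Q₂ i ∨ Q₃ i
  P⊆Q₁∪Q₂∨Q₃ : ∀ i → P i ≡ true → Q₁ i ≡ true ⊎ Q₂∨Q₃ i ≡ true
  P⊆Q₁∪Q₂∨Q₃ i p with P⊆Q i p
  ... | inj₁ q₁ = inj₁ q₁
  ... | inj₂ (inj₁ q₂) rewrite q₂ = inj₂ refl
  ... | inj₂ (inj₂ q₃) rewrite q₃ = inj₂ (∨-zeroʳ (Q₂ i))
  ∨-elim : ∀ i → Q₂∨Q₃ i ≡ true → Q₂ i ≡ true ⊎ Q₃ i ≡ true
  ∨-elim i q with Q₂ i
  ... | true = inj₁ refl
  ... | false = inj₂ q

∷-injective : {x : A} {xs : Vector A k} → Injective _≡_ _≡_ xs → (∀ j → xs j ≢ x)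
  → Injective _≡_ _≡_ (x ∷ xs)
∷-injective inj fresh {zero} {zero} _ = refl
∷-injective inj fresh {zero} {suc j} x≡xsj = ⊥-elim (fresh j (sym x≡xsj))
∷-injective inj fresh {suc i} {zero} xsi≡x = ⊥-elim (fresh i xsi≡x)
∷-injective inj fresh {suc i} {suc j} e = cong suc (inj e)

updateAt-const-elim : (P : Fin k → A → Set) {xs : Vector A k} {i : Fin k} {x : A}
  → P i x → (∀ j → j ≢ i → P j (xs j)) → ∀ j → P j (updateAt xs i (const x) j)
updateAt-const-elim P {xs} {i} {x} Pi Pj j with j ≟ i
... | yes refl rewrite updateAt-updates i {const x} xs = Pi
... | no j≢i rewrite updateAt-minimal j i {const x} xs j≢i = Pj j j≢i

updateAt-const-injective : {xs : Vector A k} {i : Fin k} {x : A} → Injective _≡_ _≡_ xs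
  → (∀ j → xs j ≢ x) → Injective _≡_ _≡_ (updateAt xs i (const x))
updateAt-const-injective {xs = xs} {i} {x} inj fresh {j} {j'} e with j ≟ i | j' ≟ i
... | yes refl | yes refl = refl
... | yes refl | no j'≢i =
  ⊥-elim (fresh j' (trans (sym (updateAt-minimal j' i xs j'≢i)) (trans (sym e) (updateAt-updates i xs))))
... | no j≢i | yes refl =
  ⊥-elim (fresh j (trans (sym (updateAt-minimal j i xs j≢i)) (trans e (updateAt-updates i xs))))
... | no j≢i | no j'≢i =
  inj (trans (sym (updateAt-minimal j i xs j≢i)) (trans e (updateAt-minimal j' i xs j'≢i)))

isPart-refl : ∀ X → isPart X X ≡ true
isPart-refl pA = refl
isPart-refl pB = refl
isPart-refl pS = refl
isPart-refl pT = refl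

isPart-sound : ∀ p X → isPart p X ≡ true → p ≡ X
isPart-sound pA pA _ = refl
isPart-sound pB pB _ = refl
isPart-sound pS pS _ = refl
isPart-sound pT pT _ = refl

_≟ᴾ_ : (p X : Part) → Dec (p ≡ X)
p ≟ᴾ X = map′ (isPart-sound p X) (λ { refl → isPart-refl X }) (isPart p X Bool.≟ true)

partSize-sum : (lab : Fin m → Part)
  → partSize lab pA + partSize lab pB + partSize lab pS + partSize lab pT ≡ m
partSize-sum {zero} lab = refl
partSize-sum {suc m} lab with lab zero | partSize-sum (lab ∘ suc)
... | pA | IH = cong suc IH
... | pB | IH = trans (cong (λ z → z + size pS + size pT) (+-suc (size pA) (size pB))) (cong suc IH)
  where size : Part → ℕ
        size = partSize (lab ∘ suc)
... | pS | IH = trans (cong (_+ size pT) (+-suc (size pA + size pB) (size pS))) (cong suc IH)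
  where size : Part → ℕ
        size = partSize (lab ∘ suc)
... | pT | IH = trans (+-suc (size pA + size pB + size pS) (size pT)) (cong suc IH)
  where size : Part → ℕ
        size = partSize (lab ∘ suc)

isSorB isTorB : Part → Bool
isSorB pS = true
isSorB pB = true
isSorB _ = false
isTorB pT = true
isTorB pB = true
isTorB _ = false

degree-bounds-incompatible : ∀ {n a b s t s' t' d O I p q} → b ≡ a + d → a + b + s + t ≡ n
  → s ≡ suc s' → t ≡ suc t' → n ≤ O + O → n ≤ I + I → O ≤ a + (t' + p) → I ≤ a + (s' + q)
  → p + q ≤ d → ⊥
degree-bounds-incompatible {a = a} {s' = s'} {t'} {d} {O} {I} {p} {q}
  refl refl refl refl n≤2O n≤2I O≤a+t'+p I≤a+s'+q p+q≤d =
  <-irrefl refl (begin-strict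
    X + X                  <⟨ +-mono-< X<n X<n ⟩
    n + n                  ≤⟨ +-mono-≤ n≤2O n≤2I ⟩
    (O + O) + (I + I)      ≡⟨ regroup O I ⟩
    (O + I) + (O + I)      ≤⟨ +-mono-≤ O+I≤X O+I≤X ⟩
    X + X                  ∎)
  where
  open ≤-Reasoning
  n X : ℕ
  n = a + (a + d) + suc s' + suc t'
  X = a + a + t' + s' + d
  regroup : ∀ O I → (O + O) + (I + I) ≡ (O + I) + (O + I)
  regroup = solve-∀
  n≡2+X : ∀ a d s' t' → a + (a + d) + suc s' + suc t' ≡ suc (suc (a + a + t' + s' + d))
  n≡2+X = solve-∀
  collect : ∀ a t' s' p q → (a + (t' + p)) + (a + (s' + q)) ≡ (a + a + t' + s') + (p + q)
  collect = solve-∀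
  X<n : X < n
  X<n = ≤-trans (n≤1+n (suc X)) (≤-reflexive (sym (n≡2+X a d s' t')))
  O+I≤X : O + I ≤ X
  O+I≤X = begin
    O + I                               ≤⟨ +-mono-≤ O≤a+t'+p I≤a+s'+q ⟩
    (a + (t' + p)) + (a + (s' + q))     ≡⟨ collect a t' s' p q ⟩
    (a + a + t' + s') + (p + q)         ≤⟨ +-monoʳ-≤ (a + a + t' + s') p+q≤d ⟩
    X                                   ∎

module _ {n : ℕ} (G : Digraph n) (lab : Fin n → Part) where

  TSEdge : Set
  TSEdge = Σ (Fin n) (λ x → Σ (Fin n) (λ y → (lab x ≡ pT) × (lab y ≡ pS) × (adj G x y ≡ true)))

  TSEdge? : Dec TSEdge
  TSEdge? = any? λ x → any? λ y → (lab x ≟ᴾ pT) ×-dec (lab y ≟ᴾ pS) ×-dec (adj G x y Bool.≟ true)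

  record Family (k : ℕ) : Set where
    field
      tail head       : Fin k → Fin n
      isEdge          : ∀ i → adj G (tail i) (head i) ≡ true
      allowed         : ∀ i → Allowed lab (tail i , head i)
      tail-injective  : Injective _≡_ _≡_ tail
      head-injective  : Injective _≡_ _≡_ head
      meetsTS         : TSEdge → ∃ λ i → EdgeType lab pT pS (tail i , head i)

  open Family

  allowed-T : ∀ {u v} → lab u ≡ pT → isSorB (lab v) ≡ true → Allowed lab (u , v)
  allowed-T {v = v} u∈T v∈S∪B with lab v | v∈S∪B
  ... | pB | _ = inj₂ (inj₁ (u∈T , refl))
  ... | pS | _ = inj₁ (u∈T , refl)

  allowed-S : ∀ {u v} → isTorB (lab u) ≡ true → lab v ≡ pS → Allowed lab (u , v)
  allowed-S {u = u} u∈T∪B v∈S with lab u | u∈T∪B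
  ... | pB | _ = inj₂ (inj₂ (refl , v∈S))
  ... | pT | _ = inj₁ (refl , v∈S)

  allowed-tail : ∀ {u v} → Allowed lab (u , v) → isTorB (lab u) ≡ true
  allowed-tail (inj₁ (u∈T , _)) rewrite u∈T = refl
  allowed-tail (inj₂ (inj₁ (u∈T , _))) rewrite u∈T = refl
  allowed-tail (inj₂ (inj₂ (u∈B , _))) rewrite u∈B = refl

  allowed-head : ∀ {u v} → Allowed lab (u , v) → isSorB (lab v) ≡ true
  allowed-head (inj₁ (_ , v∈S)) rewrite v∈S = refl
  allowed-head (inj₂ (inj₁ (_ , v∈B))) rewrite v∈B = refl
  allowed-head (inj₂ (inj₂ (_ , v∈S))) rewrite v∈S = refl

  emptyFamily : ¬ TSEdge → Family 0
  emptyFamily noTS = record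
    { tail = λ () ; head = λ ()
    ; isEdge = λ () ; allowed = λ ()
    ; tail-injective = λ { {()} } ; head-injective = λ { {()} }
    ; meetsTS = ⊥-elim ∘ noTS
    }

  singletonFamily : TSEdge → Family 1
  singletonFamily (x , y , x∈T , y∈S , xy) = record
    { tail = const x ; head = const y
    ; isEdge = const xy ; allowed = const (inj₁ (x∈T , y∈S))
    ; tail-injective = λ { {zero} {zero} _ → refl } ; head-injective = λ { {zero} {zero} _ → refl }
    ; meetsTS = const (zero , x∈T , y∈S)
    }

  extend : (F : Family k) {u v : Fin n} → adj G u v ≡ true → Allowed lab (u , v)
    → (∀ i → tail F i ≢ u) → (∀ i → head F i ≢ v) → Family (suc k)
  extend F {u} {v} uv allowed-uv u-fresh v-fresh = record
    { tail = u ∷ tail F ; head = v ∷ head F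
    ; isEdge = λ { zero → uv ; (suc i) → isEdge F i }
    ; allowed = λ { zero → allowed-uv ; (suc i) → allowed F i }
    ; tail-injective = ∷-injective (tail-injective F) u-fresh
    ; head-injective = ∷-injective (head-injective F) v-fresh
    ; meetsTS = λ e → let (i , i∈TS) = meetsTS F e in suc i , i∈TS
    }

  switch : (F : Family k) (i : Fin k) {x y : Fin n} → lab x ≡ pT → lab y ≡ pS
    → (∀ j → tail F j ≢ x) → (∀ j → head F j ≢ y)
    → adj G x (head F i) ≡ true → adj G (tail F i) y ≡ true → Family (suc k)
  switch {k} F i {x} {y} x∈T y∈S x-fresh y-fresh xv uy = record
    { tail = tail F i ∷ tail₁ ; head = y ∷ head F
    ; isEdge = λ { zero → uy ; (suc j) → isEdge₁ j }
    ; allowed = λ { zero → allowed-S (allowed-tail (allowed F i)) y∈S ; (suc j) → allowed₁ j }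
    ; tail-injective = ∷-injective (updateAt-const-injective (tail-injective F) x-fresh) u-fresh
    ; head-injective = ∷-injective (head-injective F) y-fresh
    ; meetsTS = meetsTS₁
    }
    where
    tail₁ : Fin k → Fin n
    tail₁ = updateAt (tail F) i (const x)
    isEdge₁ : ∀ j → adj G (tail₁ j) (head F j) ≡ true
    isEdge₁ = updateAt-const-elim (λ j u → adj G u (head F j) ≡ true) xv (λ j _ → isEdge F j)
    allowed₁ : ∀ j → Allowed lab (tail₁ j , head F j)
    allowed₁ = updateAt-const-elim (λ j u → Allowed lab (u , head F j))
      (allowed-T x∈T (allowed-head (allowed F i))) (λ j _ → allowed F j)
    u-fresh : ∀ j → tail₁ j ≢ tail F i
    u-fresh = updateAt-const-elim (λ j u → u ≢ tail F i) (x-fresh i ∘ sym)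
      (λ j j≢i → j≢i ∘ tail-injective F)
    meetsTS₁ : TSEdge → ∃ λ j → EdgeType lab pT pS ((tail F i ∷ tail₁) j , (y ∷ head F) j)
    meetsTS₁ e with meetsTS F e
    ... | j , j∈T , j∈S with j ≟ i
    ...   | yes refl = zero , j∈T , y∈S
    ...   | no j≢i =
      suc j , subst (λ u → lab u ≡ pT) (sym (updateAt-minimal j i (tail F) j≢i)) j∈T , j∈S

  TorB∩SorB⊆B : ∀ p → isTorB p ≡ true → isSorB p ≡ true → p ≡ pB
  TorB∩SorB⊆B pB _ _ = refl

  toGoodCollection : ∀ {d} (F : Family (suc d)) → GoodCollection G lab d (λ i → tail F i , head F i)
  toGoodCollection F = isEdge F , allowed F , outside-B-distinct
    , (λ i j _ _ → head-injective F) , (λ i j _ _ → tail-injective F)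
    where
    outside-B-distinct : ∀ i j (x y : Bool)
      → endpoint (tail F i , head F i) x ≡ endpoint (tail F j , head F j) y
      → lab (endpoint (tail F i , head F i) x) ≢ pB → i ≡ j × x ≡ y
    outside-B-distinct i j false false e _ = tail-injective F e , refl
    outside-B-distinct i j true true e _ = head-injective F e , refl
    outside-B-distinct i j false true e ∉B = ⊥-elim (∉B (TorB∩SorB⊆B _ (allowed-tail (allowed F i))
      (subst (λ w → isSorB (lab w) ≡ true) (sym e) (allowed-head (allowed F j)))))
    outside-B-distinct i j true false e ∉B = ⊥-elim (∉B (TorB∩SorB⊆B _
      (subst (λ w → isTorB (lab w) ≡ true) (sym e) (allowed-tail (allowed F j)))
      (allowed-head (allowed F i))))

  inPart : Part → Fin n → Bool
  inPart X w = isPart (lab w) X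

  inPart⁺ : ∀ {X w} → lab w ≡ X → inPart X w ≡ true
  inPart⁺ {X} w∈X = subst (λ p → isPart p X ≡ true) (sym w∈X) (isPart-refl X)

  neighbourhood-bound : (N : Fin n → Bool) (v : Fin n) (X : Part) (R : Part → Bool)
    → (∀ p → p ≡ pA ⊎ p ≡ X ⊎ R p ≡ true) → N v ≡ false
    → count N ≤ partSize lab pA + (count (inPart X without v) + count (λ w → N w ∧ R (lab w)))
  neighbourhood-bound N v X R cover v∉N = count-≤-∪₃ N (inPart pA) (inPart X without v) _ split
    where
    split : ∀ w → N w ≡ true
      → inPart pA w ≡ true ⊎ (inPart X without v) w ≡ true ⊎ (N w ∧ R (lab w)) ≡ true
    split w w∈N with cover (lab w)
    ... | inj₁ w∈A = inj₁ (inPart⁺ w∈A)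
    ... | inj₂ (inj₁ w∈X) = inj₂ (inj₁ (without-⁺ (inPart X) {v} w≢v (inPart⁺ w∈X)))
      where w≢v : w ≢ v
            w≢v refl = case trans (sym w∈N) v∉N of λ ()
    ... | inj₂ (inj₂ r) = inj₂ (inj₂ (trans (cong (_∧ R (lab w)) w∈N) r))

  vertex-outside-image : (X : Part) (g : Fin k → Fin n) → k < partSize lab X
    → ∃ λ x → lab x ≡ X × ∀ i → g i ≢ x
  vertex-outside-image X g k<|X| with missed-or-count-≤-image (inPart X) g
  ... | inj₁ (x , x∈X , missed) = x , isPart-sound _ X x∈X , missed
  ... | inj₂ |X|≤ = ⊥-elim (<-irrefl refl (≤-trans k<|X| (≤-trans |X|≤ (count-≤-size _))))

  module _ (δ⁰ : MinSemidegreeHalf G) {d : ℕ}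
    (b≡a+d : partSize lab pB ≡ partSize lab pA + d)
    (s≤t : partSize lab pS ≤ partSize lab pT)
    (d+2≤s : suc (suc d) ≤ partSize lab pS) where

    stuck-impossible : (F : Family k) → k ≤ d → ∀ {x y} → lab x ≡ pT → lab y ≡ pS
      → count (λ w → adj G x w ∧ isSorB (lab w))
        ≤ count (λ i → adj G x (head F i) ∧ isSorB (lab (head F i)))
      → count (λ w → adj G w y ∧ isTorB (lab w))
        ≤ count (λ i → adj G (tail F i) y ∧ isTorB (lab (tail F i)))
      → (∀ i → adj G x (head F i) ≡ true → adj G (tail F i) y ≡ true → ⊥) → ⊥
    stuck-impossible F k≤d {x} {y} x∈T y∈S out-covered in-covered no-switch =
      degree-bounds-incompatible b≡a+d (partSize-sum lab)
        (count-without (inPart pS) y (inPart⁺ y∈S)) (count-without (inPart pT) x (inPart⁺ x∈T))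
        (proj₁ (δ⁰ x)) (proj₂ (δ⁰ y)) out-bound in-bound
        (≤-trans (count-disjoint _ _ no-switch) k≤d)
      where
      T-cover : ∀ p → p ≡ pA ⊎ p ≡ pT ⊎ isSorB p ≡ true
      T-cover pA = inj₁ refl
      T-cover pB = inj₂ (inj₂ refl)
      T-cover pS = inj₂ (inj₂ refl)
      T-cover pT = inj₂ (inj₁ refl)
      S-cover : ∀ p → p ≡ pA ⊎ p ≡ pS ⊎ isTorB p ≡ true
      S-cover pA = inj₁ refl
      S-cover pB = inj₂ (inj₂ refl)
      S-cover pS = inj₂ (inj₁ refl)
      S-cover pT = inj₂ (inj₂ refl)
      out-bound : outdeg G x
        ≤ partSize lab pA + (count (inPart pT without x) + count (λ i → adj G x (head F i)))
      out-bound = ≤-trans (neighbourhood-bound (adj G x) x pT isSorB T-cover (loopless G x))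
        (+-monoʳ-≤ (partSize lab pA) (+-monoʳ-≤ (count (inPart pT without x))
          (≤-trans out-covered (count-mono _ (λ i → adj G x (head F i)) (λ i → ∧-conicalˡ _ _)))))
      in-bound : indeg G y
        ≤ partSize lab pA + (count (inPart pS without y) + count (λ i → adj G (tail F i) y))
      in-bound = ≤-trans (neighbourhood-bound (λ w → adj G w y) y pS isTorB S-cover (loopless G y))
        (+-monoʳ-≤ (partSize lab pA) (+-monoʳ-≤ (count (inPart pS without y))
          (≤-trans in-covered (count-mono _ (λ i → adj G (tail F i) y) (λ i → ∧-conicalˡ _ _)))))

    <|S| : k ≤ d → k < partSize lab pS
    <|S| k≤d = ≤-trans (s≤s (m≤n⇒m≤1+n k≤d)) d+2≤s

    augment : k ≤ d → Family k → Family (suc k)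
    augment k≤d F
      with vertex-outside-image pT (tail F) (≤-trans (<|S| k≤d) s≤t)
         | vertex-outside-image pS (head F) (<|S| k≤d)
    ... | x , x∈T , x-fresh | y , y∈S , y-fresh
      with missed-or-count-≤-image (λ w → adj G x w ∧ isSorB (lab w)) (head F)
    ... | inj₁ (w , xw , w-fresh) =
      extend F (∧-conicalˡ _ _ xw) (allowed-T x∈T (∧-conicalʳ _ _ xw)) x-fresh w-fresh
    ... | inj₂ out-covered with missed-or-count-≤-image (λ w → adj G w y ∧ isTorB (lab w)) (tail F)
    ... | inj₁ (w , wy , w-fresh) =
      extend F (∧-conicalˡ _ _ wy) (allowed-S (∧-conicalʳ _ _ wy) y∈S) w-fresh y-fresh
    ... | inj₂ in-covered
      with any? (λ i → (adj G x (head F i) Bool.≟ true) ×-dec (adj G (tail F i) y Bool.≟ true))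
    ... | yes (i , xv , uy) = switch F i x∈T y∈S x-fresh y-fresh xv uy
    ... | no no-switch = ⊥-elim (stuck-impossible F k≤d x∈T y∈S out-covered in-covered
                                   (λ i xv uy → no-switch (i , xv , uy)))

    grow : ∀ j {k} → j + k ≡ suc d → Family k → Family (suc d)
    grow zero refl F = F
    grow (suc j) {k} j+1+k≡1+d F =
      grow j (trans (+-suc j k) j+1+k≡1+d) (augment k≤d F)
      where k≤d : k ≤ d
            k≤d = ≤-trans (m≤n+m k j) (≤-reflexive (suc-injective j+1+k≡1+d))

    family : Family (suc d)
    family with TSEdge?
    ... | yes ts = grow d (+-comm d 1) (singletonFamily ts)
    ... | no noTS = grow (suc d) (+-identityʳ (suc d)) (emptyFamily noTS)

proposition5p6 : (n : ℕ) (G : Digraph n) → MinSemidegreeHalf G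
    → (d : ℕ) (lab : Fin n → Part)
    → partSize lab pB ≡ partSize lab pA + d
    → partSize lab pS ≤ partSize lab pT
    → suc (suc d) ≤ partSize lab pS
    → Σ (Fin (suc d) → Fin n × Fin n) (λ M →
        GoodCollection G lab d M
        × ((Σ (Fin n) (λ x → Σ (Fin n) (λ y → (lab x ≡ pT) × (lab y ≡ pS) × (adj G x y ≡ true))))
           → Σ (Fin (suc d)) (λ i → EdgeType lab pT pS (M i))))
proposition5p6 n G δ⁰ d lab b≡a+d s≤t d+2≤s =
  (λ i → tail F i , head F i) , toGoodCollection G lab F , meetsTS F
  where
  open Family
  F : Family G lab (suc d)
  F = family G lab δ⁰ b≡a+d s≤t d+2≤s
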